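{- There exists a family of binary strings $w$ such that the ratio $\mathrm{z}_{\mathrm{End}}(w)/\mathrm{z}_{77}(w)$ asymptotically approaches $2$, where $\mathrm{z}_{\mathrm{End}}(w)$ and $\mathrm{z}_{77}(w)$ are the numbers of phrases in the LZ-End and LZ77 factorizations of $w$, respectively.
   Context: The LZ77 factorization (non-overlapping, without self-references) of a string $w$ is the factorization $w=p_1\cdots p_z$ built greedily from left to right such that, for each $i$, $p_i[1..|p_i|-1]$ is the longest prefix of $p_i\cdots p_z$ that occurs as a substring of $p_1\cdots p_{i-1}$ (and $p_i$ is that prefix extended by one more character); as an exception, the last phrase $p_z$ may be a suffix of $w$ that occurs in $p_1\cdots p_{z-1}$. The LZ-End factorization of $w$ is the factorization $w=q_1\cdots q_{z'}$ built greedily from left to right such that, for each $i$, $q_i[1..|q_i|-1]$ is the longest prefix of $q_i\cdots q_{z'}$ that occurs as a suffix of $q_1\cdots q_j$ for some $j<i$ (and $q_i$ is that prefix extended by one more character); as an exception, the last phrase $q_{z'}$ may be a suffix of $w$ that occurs as a suffix of $q_1\cdots q_j$ for some $j<z'$. A binary string is a string over a two-letter alphabet. -}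

module Defs where

open import Data.Bool using (Bool)
open import Data.Nat using (ℕ; suc; _≤_; _*_; ∣_-_∣)
open import Data.List using (List; []; _∷_; _++_; [_]; concat; length; take)
open import Data.Product using (Σ; ∃; ∃₂; _×_; _,_)
open import Data.Sum using (_⊎_)
open import Data.Unit using (⊤)
open import Relation.Binary.PropositionalEquality using (_≡_; _≢_)

BinStr : Set
BinStr = List Bool

Factor : BinStr → BinStr → Set
Factor u s = ∃₂ λ x y → x ++ u ++ y ≡ s

Prefix : BinStr → BinStr → Set
Prefix u s = ∃ λ y → u ++ y ≡ s

Suffix : BinStr → BinStr → Set
Suffix u s = ∃ λ x → x ++ u ≡ s

-- LZ77 (non-overlapping, no self-references)

-- Condition on phrase p, given the previously produced phrases prev
-- (so P = p_1⋯p_{i-1} = concat prev) and the phrases ps following p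
-- (so the remaining text is R = p ++ concat ps).
Phrase77 : List BinStr → BinStr → List BinStr → Set
Phrase77 prev p ps =
    (Σ BinStr λ u → Σ Bool λ c →
        p ≡ u ++ [ c ]
      × Prefix u R
      × Factor u P
      × (∀ v → Prefix v R → Factor v P → length v ≤ length u))
  ⊎ (ps ≡ [] × p ≢ [] × Factor p P)   -- exception for the last phrase
  where
    P = concat prev
    R = p ++ concat ps

Good77 : List BinStr → List BinStr → Set
Good77 prev []       = ⊤
Good77 prev (p ∷ ps) = Phrase77 prev p ps × Good77 (prev ++ [ p ]) ps

IsLZ77 : BinStr → List BinStr → Set
IsLZ77 w fs = concat fs ≡ w × Good77 [] fs

-- u occurs as a suffix of q_1⋯q_j for some j < i, where prev = q_1,…,q_{i-1}
-- (j = 0 gives the empty prefix, whose only suffix is the empty string).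
EndOcc : List BinStr → BinStr → Set
EndOcc prev u = ∃ λ j → j ≤ length prev × Suffix u (concat (take j prev))

PhraseEnd : List BinStr → BinStr → List BinStr → Set
PhraseEnd prev p ps =
    (Σ BinStr λ u → Σ Bool λ c →
        p ≡ u ++ [ c ]
      × Prefix u R
      × EndOcc prev u
      × (∀ v → Prefix v R → EndOcc prev v → length v ≤ length u))
  ⊎ (ps ≡ [] × p ≢ [] × EndOcc prev p)
  where
    R = p ++ concat ps

GoodEnd : List BinStr → List BinStr → Set
GoodEnd prev []       = ⊤
GoodEnd prev (p ∷ ps) = PhraseEnd prev p ps × GoodEnd (prev ++ [ p ]) ps

IsLZEnd : BinStr → List BinStr → Set
IsLZEnd w fs = concat fs ≡ w × GoodEnd [] fs

-- a k / b k → 2 :  for every m, eventually |a k / b k - 2| ≤ 1/(m+1),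
-- written without division as |a k - 2·b k|·(m+1) ≤ b k.
RatioTendsTo2 : (ℕ → ℕ) → (ℕ → ℕ) → Set
RatioTendsTo2 a b = ∀ m → ∃ λ N → ∀ k → N ≤ k → ∣ a k - 2 * b k ∣ * suc m ≤ b k

-- Take w = aᴺ b aᴺ⁺¹ b a² b a³ b ⋯ a²ʰ⁺² b with N = 2ᵗ⁺¹ − 1 and 2h + 3 ≤ N.  Both
-- factorizations spend t + 1 doubling phrases on aᴺ and three phrases on b, aᴺ⁺¹ and the
-- start of the middle.  From then on LZ77 copies two runs per phrase, aᵉ b aᵉ⁺¹ b, since
-- aᵉ b aᵉ⁺¹ occurs in aᴺ b aᴺ⁺¹ while b aᵉ⁺¹ b is new: h phrases.  An LZ-End source must
-- end at a phrase boundary, and every boundary ends in b aᵈ with d at most the current run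
-- or d = N + 1; so each LZ-End phrase a b aᵈ⁺¹ stops right after its only b, and the middle
-- costs 2h + 1 phrases.  With h = k² the counts t + 5 + 2h and t + 4 + h have ratio → 2.
module Submission where

open import Defs
open import Data.Nat using (ℕ; _≤_)
open import Data.List using (List; length)
open import Data.Product using (Σ; ∃; _×_)
open import Data.Bool using (Bool; true; false)
open import Data.Nat using (zero; suc; _+_; _*_; _∸_; _<_; z≤n; s≤s; _≤?_; ∣_-_∣)
open import Data.Nat.Properties
open import Data.Nat.Tactic.RingSolver using (solve-∀)
open import Data.List using ([]; _∷_; _++_; [_]; concat; take; drop; replicate)
open import Data.List.Properties
  using (++-assoc; ++-identityʳ; ++-cancelˡ; concat-++; length-++; length-++-≤ˡ;
         length-replicate; take++drop≡id; take-all; ∷-injective; ∷-injectiveʳ)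
open import Data.List.Membership.Propositional using (_∈_; _∉_)
open import Data.List.Relation.Unary.Any using (here; there)
open import Data.List.Relation.Unary.All as All using (All; []; _∷_)
open import Data.List.Relation.Unary.All.Properties using (++⁺; ∷ʳ⁺)
open import Data.Product using (_,_; proj₂)
open import Data.Sum as Sum using (_⊎_; inj₁; inj₂)
open import Data.Empty using (⊥-elim)
open import Data.Unit using (tt)
open import Relation.Nullary using (¬_; yes; no)
open import Relation.Binary.PropositionalEquality hiding ([_])

a b : Bool
a = false
b = true

a^_ : ℕ → BinStr
a^ n = replicate n a

blocks : List ℕ → BinStr → BinStr
blocks []       t = t
blocks (d ∷ ds) t = a^ d ++ b ∷ blocks ds t

upFrom : ℕ → ℕ → List ℕ
upFrom e zero    = []
upFrom e (suc n) = e ∷ upFrom (suc e) n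

length-∷ʳ : ∀ {A : Set} (xs : List A) x → length (xs ++ [ x ]) ≡ suc (length xs)
length-∷ʳ xs x = trans (length-++ xs) (+-comm (length xs) 1)

concat-∷ʳ : ∀ (xss : List BinStr) xs → concat (xss ++ [ xs ]) ≡ concat xss ++ xs
concat-∷ʳ xss xs = trans (sym (concat-++ xss [ xs ])) (cong (concat xss ++_) (++-identityʳ xs))

take-++-≤ : ∀ {A : Set} {j} (xs ys : List A) → j ≤ length xs → take j (xs ++ ys) ≡ take j xs
take-++-≤ {j = zero}  xs       ys _         = refl
take-++-≤ {j = suc j} (x ∷ xs) ys (s≤s j≤) = cong (x ∷_) (take-++-≤ xs ys j≤)

a^-++ : ∀ m n → a^ m ++ a^ n ≡ a^ (m + n)
a^-++ zero    n = refl
a^-++ (suc m) n = cong (a ∷_) (a^-++ m n)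

a^-suc : ∀ n s → a^ n ++ a ∷ s ≡ a^ (suc n) ++ s
a^-suc zero    s = refl
a^-suc (suc n) s = cong (a ∷_) (a^-suc n s)

a^-∷ʳ : ∀ n → a^ n ++ [ a ] ≡ a^ (suc n)
a^-∷ʳ n = trans (a^-suc n []) (++-identityʳ (a^ (suc n)))

blocks-++ : ∀ ds es t → blocks (ds ++ es) t ≡ blocks ds (blocks es t)
blocks-++ []       es t = refl
blocks-++ (d ∷ ds) es t = cong (λ s → a^ d ++ b ∷ s) (blocks-++ ds es t)

blocks-++-tail : ∀ ds s t → blocks ds s ++ t ≡ blocks ds (s ++ t)
blocks-++-tail []       s t = refl
blocks-++-tail (d ∷ ds) s t =
  trans (++-assoc (a^ d) (b ∷ blocks ds s) t) (cong (λ r → a^ d ++ b ∷ r) (blocks-++-tail ds s t))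

blocks-∷ : ∀ d ds t → ∃ λ y → blocks (d ∷ ds) t ≡ y ++ b ∷ t
blocks-∷ d []        t = a^ d , refl
blocks-∷ d (d′ ∷ ds) t with blocks-∷ d′ ds t
... | y , eq = a^ d ++ b ∷ y ,
  trans (cong (λ s → a^ d ++ b ∷ s) eq) (sym (++-assoc (a^ d) (b ∷ y) (b ∷ t)))

factor-[] : ∀ {s} → Factor [] s
factor-[] {s} = [] , s , refl

prefix⇒factor : ∀ {u s} → Prefix u s → Factor u s
prefix⇒factor (y , eq) = [] , y , eq

suffix⇒factor : ∀ {u s} → Suffix u s → Factor u s
suffix⇒factor {u} (x , eq) = x , [] , trans (cong (x ++_) (++-identityʳ u)) eq

suffix-++ˡ : ∀ {u s} w → Suffix u s → Suffix u (w ++ s)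
suffix-++ˡ {u} w (x , eq) = w ++ x , trans (++-assoc w x u) (cong (w ++_) eq)

a^-suffix : ∀ {n} s → 1 ≤ n → Suffix (a ∷ s) (a^ n ++ s)
a^-suffix {suc n} s _ = a^ n , a^-suc n s

factor-length : ∀ {v s} → Factor v s → length v ≤ length s
factor-length {v} (x , y , refl) = begin
  length v                   ≤⟨ m≤n+m (length v) (length x) ⟩
  length x + length v        ≤⟨ +-monoʳ-≤ (length x) (length-++-≤ˡ v) ⟩
  length x + length (v ++ y) ≡⟨ length-++ x ⟨
  length (x ++ v ++ y)       ∎
  where open ≤-Reasoning

factor-same-length : ∀ {v s} → Factor v s → length s ≤ length v → v ≡ s
factor-same-length {v} ([] , [] , eq) _ = trans (sym (++-identityʳ v)) eq
factor-same-length {v} ([] , c ∷ y , refl) long =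
  ⊥-elim (m+1+n≰m (length v) (≤-trans (≤-reflexive (sym (length-++ v))) long))
factor-same-length (c ∷ x , y , refl) long = ⊥-elim (<⇒≱ (s≤s (factor-length (x , y , refl))) long)

factor-dropʳ : ∀ {s r P} → Factor (s ++ r) P → Factor s P
factor-dropʳ {s} {r} (x , y , eq) = x , r ++ y , trans (cong (x ++_) (sym (++-assoc s r y))) eq

factor-dropˡ : ∀ {v P} w → Factor (w ++ v) P → Factor v P
factor-dropˡ {v} w (x , y , eq) =
  x ++ w , y , trans (++-assoc x w (v ++ y)) (trans (cong (x ++_) (sym (++-assoc w v y))) eq)

factor-∷⁻ : ∀ {v c s} → Factor v (c ∷ s) → Prefix v (c ∷ s) ⊎ Factor v s
factor-∷⁻ ([]    , y , eq) = inj₁ (y , eq)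
factor-∷⁻ (_ ∷ x , y , eq) = inj₂ (x , y , ∷-injectiveʳ eq)

prefix-++⁻ : ∀ {v} s {t} → Prefix v (s ++ t) → length s ≤ length v →
             ∃ λ r → v ≡ s ++ r × Prefix r t
prefix-++⁻ {v} [] pv _ = v , refl , pv
prefix-++⁻ {c′ ∷ v} (c ∷ s) (y , eq) (s≤s s≤v) with ∷-injective eq
... | refl , eq′ with prefix-++⁻ s (y , eq′) s≤v
...   | r , refl , pr = r , refl , pr

-- Runs of a's

b-not-in-a^ : ∀ n {s} → ¬ Factor (b ∷ s) (a^ n)
b-not-in-a^ zero    ([]    , _ , ())
b-not-in-a^ zero    (_ ∷ _ , _ , ())
b-not-in-a^ (suc n) f with factor-∷⁻ f
... | inj₁ (_ , ())
... | inj₂ f′ = b-not-in-a^ n f′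

b-factor-a^-++ : ∀ n {s t} → Factor (b ∷ s) (a^ n ++ t) → Factor (b ∷ s) t
b-factor-a^-++ zero    f = f
b-factor-a^-++ (suc n) f with factor-∷⁻ f
... | inj₁ (_ , ())
... | inj₂ f′ = b-factor-a^-++ n f′

a^-suc-not-in-a^ : ∀ n → ¬ Factor (a^ (suc n)) (a^ n)
a^-suc-not-in-a^ n f =
  1+n≰n (subst₂ _≤_ (length-replicate (suc n)) (length-replicate n) (factor-length f))

a^-suc-not-in-a^-b : ∀ n → ¬ Factor (a^ (suc n)) (a^ n ++ [ b ])
a^-suc-not-in-a^-b n f
  with ++-cancelˡ (a^ n) [ a ] [ b ]
         (trans (a^-∷ʳ n) (factor-same-length f (≤-reflexive (length-∷ʳ (a^ n) b))))
... | ()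

a^-b-a^-factor : ∀ {e m f n} z → e ≤ m → f ≤ n →
                 Factor (a^ e ++ b ∷ a^ f) (a^ m ++ b ∷ a^ n ++ z)
a^-b-a^-factor {e} {m} {f} {n} z e≤m f≤n = a^ (m ∸ e) , a^ (n ∸ f) ++ z , (begin
  a^ (m ∸ e) ++ (a^ e ++ b ∷ a^ f) ++ a^ (n ∸ f) ++ z
    ≡⟨ cong (a^ (m ∸ e) ++_) (++-assoc (a^ e) (b ∷ a^ f) _) ⟩
  a^ (m ∸ e) ++ a^ e ++ b ∷ a^ f ++ a^ (n ∸ f) ++ z
    ≡⟨ ++-assoc (a^ (m ∸ e)) (a^ e) _ ⟨
  (a^ (m ∸ e) ++ a^ e) ++ b ∷ a^ f ++ a^ (n ∸ f) ++ z
    ≡⟨ cong₂ (λ x y → x ++ b ∷ y) left (trans (sym (++-assoc (a^ f) _ z)) (cong (_++ z) right)) ⟩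
  a^ m ++ b ∷ a^ n ++ z ∎)
  where
  open ≡-Reasoning
  left : a^ (m ∸ e) ++ a^ e ≡ a^ m
  left = trans (a^-++ (m ∸ e) e) (cong a^_ (m∸n+n≡m e≤m))
  right : a^ f ++ a^ (n ∸ f) ≡ a^ n
  right = trans (a^-++ f (n ∸ f)) (cong a^_ (m+[n∸m]≡n f≤n))

a^-b-prefix-≡ : ∀ d e {s t} → Prefix (a^ d ++ b ∷ s) (a^ e ++ b ∷ t) → d ≡ e
a^-b-prefix-≡ zero    zero    _        = refl
a^-b-prefix-≡ zero    (suc e) (_ , ())
a^-b-prefix-≡ (suc d) zero    (_ , ())
a^-b-prefix-≡ (suc d) (suc e) (y , eq) = cong suc (a^-b-prefix-≡ d e (y , ∷-injectiveʳ eq))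

a^-b-not-prefix-a^ : ∀ d r {s} → ¬ Prefix (a^ d ++ b ∷ s) (a^ r)
a^-b-not-prefix-a^ zero    zero    (_ , ())
a^-b-not-prefix-a^ zero    (suc r) (_ , ())
a^-b-not-prefix-a^ (suc d) zero    (_ , ())
a^-b-not-prefix-a^ (suc d) (suc r) (y , eq) = a^-b-not-prefix-a^ d r (y , ∷-injectiveʳ eq)

block-factor : ∀ ds r {d} → Factor (b ∷ a^ d ++ [ b ]) (blocks ds (a^ r)) → d ∈ ds
block-factor []       r f = ⊥-elim (b-not-in-a^ r f)
block-factor (e ∷ ds) r f with factor-∷⁻ (b-factor-a^-++ e f)
block-factor (e ∷ ds)      r f | inj₂ f′ = there (block-factor ds r f′)
block-factor (e ∷ [])      r f | inj₁ (y , eq) =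
  ⊥-elim (a^-b-not-prefix-a^ _ r (y , ∷-injectiveʳ eq))
block-factor (e ∷ e′ ∷ ds) r f | inj₁ (y , eq) =
  there (here (a^-b-prefix-≡ _ e′ (y , ∷-injectiveʳ eq)))

fresh-length : ∀ {N d ms} → d < N → All (_< d) ms → d ∉ N ∷ suc N ∷ ms
fresh-length d<N _ (here refl) = n≮n _ d<N
fresh-length {N} d<N _ (there (here refl)) = <⇒≱ d<N (n≤1+n N)
fresh-length _ shorter (there (there d∈ms)) = n≮n _ (All.lookup shorter d∈ms)

last-run-≡ : ∀ x y {d e} → x ++ b ∷ a^ d ≡ y ++ b ∷ a^ e → d ≡ e
last-run-≡ [] [] {d} {e} eq =
  trans (sym (length-replicate d)) (trans (cong length (∷-injectiveʳ eq)) (length-replicate e))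
last-run-≡ [] (_ ∷ y) {d} eq = ⊥-elim (b-not-in-a^ d (suffix⇒factor (y , sym (∷-injectiveʳ eq))))
last-run-≡ (_ ∷ x) [] {e = e} eq = ⊥-elim (b-not-in-a^ e (suffix⇒factor (x , ∷-injectiveʳ eq)))
last-run-≡ (_ ∷ x) (_ ∷ y) eq = last-run-≡ x y (∷-injectiveʳ eq)

last-run-blocks : ∀ {d e x xs} → Suffix (b ∷ a^ d) (blocks (x ∷ xs) (a^ e)) → d ≡ e
last-run-blocks {e = e} {x} {xs} (z , eq) with blocks-∷ x xs (a^ e)
... | y , eq′ = last-run-≡ z y (trans eq eq′)

prefix-of-phrase : ∀ {p u c} s → p ≡ u ++ [ c ] → Prefix u (p ++ s)
prefix-of-phrase {u = u} {c} s refl = c ∷ s , sym (++-assoc u [ c ] s)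

novel⇒longest : ∀ {p u c v s P} → p ≡ u ++ [ c ] → ¬ Factor p P →
                Prefix v (p ++ s) → Factor v P → length v ≤ length u
novel⇒longest {u = u} {c} {v} refl novel pv fv with length v ≤? length u
... | yes short = short
... | no long with prefix-++⁻ (u ++ [ c ]) pv (≤-trans (≤-reflexive (length-∷ʳ u c)) (≰⇒> long))
...   | r , refl , _ = ⊥-elim (novel (factor-dropʳ fv))

phrase77-novel : ∀ {prev p ps u c} → p ≡ u ++ [ c ] →
                 Factor u (concat prev) → ¬ Factor p (concat prev) → Phrase77 prev p ps
phrase77-novel {ps = ps} p≡ occ novel =
  inj₁ (_ , _ , p≡ , prefix-of-phrase (concat ps) p≡ , occ , λ v pv fv → novel⇒longest p≡ novel pv fv)

-- End occurrences

endOcc-[] : ∀ {prev} → EndOcc prev []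
endOcc-[] = 0 , z≤n , [] , refl

endOcc-++ʳ : ∀ {prev u} qs → EndOcc prev u → EndOcc (prev ++ qs) u
endOcc-++ʳ {prev} {u} qs (j , j≤ , suf) =
  j , ≤-trans j≤ (length-++-≤ˡ prev) ,
  subst (λ l → Suffix u (concat l)) (sym (take-++-≤ prev qs j≤)) suf

endOcc-last : ∀ {prev u} → Suffix u (concat prev) → EndOcc prev u
endOcc-last {prev} {u} suf =
  length prev , ≤-refl , subst (λ l → Suffix u (concat l)) (sym (take-all (length prev) prev ≤-refl)) suf

endOcc-∷ʳ⁻ : ∀ {prev u} p → EndOcc (prev ++ [ p ]) u → EndOcc prev u ⊎ Suffix u (concat (prev ++ [ p ]))
endOcc-∷ʳ⁻ {prev} {u} p (j , _ , suf) with j ≤? length prev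
... | yes j≤ = inj₁ (j , j≤ , subst (λ l → Suffix u (concat l)) (take-++-≤ prev [ p ] j≤) suf)
... | no j≰ = inj₂ (subst (λ l → Suffix u (concat l))
                      (take-all j (prev ++ [ p ]) (≤-trans (≤-reflexive (length-∷ʳ prev p)) (≰⇒> j≰))) suf)

endOcc⇒factor : ∀ {prev u} → EndOcc prev u → Factor u (concat prev)
endOcc⇒factor {prev} {u} (j , _ , x , eq) = x , concat (drop j prev) , (begin
  x ++ u ++ concat (drop j prev)                    ≡⟨ ++-assoc x u _ ⟨
  (x ++ u) ++ concat (drop j prev)                  ≡⟨ cong (_++ concat (drop j prev)) eq ⟩
  concat (take j prev) ++ concat (drop j prev)      ≡⟨ concat-++ (take j prev) (drop j prev) ⟩
  concat (take j prev ++ drop j prev)               ≡⟨ cong concat (take++drop≡id j prev) ⟩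
  concat prev                                       ∎)
  where open ≡-Reasoning

endOcc-dropˡ : ∀ {prev u} w → EndOcc prev (w ++ u) → EndOcc prev u
endOcc-dropˡ {u = u} w (j , j≤ , x , eq) = j , j≤ , x ++ w , trans (++-assoc x w u) eq

phraseEnd-novel : ∀ {prev p ps u c} → p ≡ u ++ [ c ] →
                  EndOcc prev u → ¬ Factor p (concat prev) → PhraseEnd prev p ps
phraseEnd-novel {ps = ps} p≡ occ novel =
  inj₁ (_ , _ , p≡ , prefix-of-phrase (concat ps) p≡ , occ ,
        λ v pv ov → novel⇒longest p≡ novel pv (endOcc⇒factor ov))

-- As the text continues with a b, a longer candidate is x b aⁱ⁺¹, x b aⁱ⁺² or contains
-- b aⁱ⁺² b; the three negative hypotheses rule these out.
phraseEnd-block : ∀ {prev ps z} x i →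
                  EndOcc prev (x ++ b ∷ a^ i) →
                  ¬ EndOcc prev (b ∷ a^ (suc i)) →
                  ¬ EndOcc prev (b ∷ a^ (2 + i)) →
                  ¬ Factor (b ∷ a^ (2 + i) ++ [ b ]) (concat prev) →
                  concat ps ≡ a ∷ b ∷ z →
                  PhraseEnd prev (x ++ b ∷ a^ (suc i)) ps
phraseEnd-block {prev} {ps} x i occ no-end₁ no-end₂ novel next =
  inj₁ (u , a , p≡ , prefix-of-phrase (concat ps) p≡ , occ , longest)
  where
  u = x ++ b ∷ a^ i
  p = x ++ b ∷ a^ (suc i)

  p≡ : p ≡ u ++ [ a ]
  p≡ = sym (trans (++-assoc x (b ∷ a^ i) [ a ]) (cong (λ s → x ++ b ∷ s) (a^-∷ʳ i)))

  extension-not-end : ∀ {z′} r → Prefix r (a ∷ b ∷ z′) → ¬ EndOcc prev (p ++ r)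
  extension-not-end [] _ o = no-end₁ (endOcc-dropˡ x (subst (EndOcc prev) (++-identityʳ p) o))
  extension-not-end (_ ∷ []) (_ , refl) o =
    no-end₂ (endOcc-dropˡ x (subst (EndOcc prev)
      (trans (++-assoc x (b ∷ a^ (suc i)) [ a ]) (cong (λ s → x ++ b ∷ s) (a^-∷ʳ (suc i)))) o))
  extension-not-end (_ ∷ _ ∷ r) (_ , refl) o =
    novel (factor-dropʳ (factor-dropˡ x (subst (λ s → Factor s (concat prev)) p-a-b≡ (endOcc⇒factor o))))
    where
    p-a-b≡ : p ++ a ∷ b ∷ r ≡ x ++ (b ∷ a^ (2 + i) ++ [ b ]) ++ r
    p-a-b≡ = trans (++-assoc x (b ∷ a^ (suc i)) _)
               (cong (λ s → x ++ b ∷ s) (trans (a^-suc (suc i) (b ∷ r)) (sym (++-assoc (a^ (2 + i)) [ b ] r))))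

  longest : ∀ v → Prefix v (p ++ concat ps) → EndOcc prev v → length v ≤ length u
  longest v pv ov with length v ≤? length u
  ... | yes short = short
  ... | no long with prefix-++⁻ p (subst (λ s → Prefix v (p ++ s)) next pv)
                       (≤-trans (≤-reflexive (trans (cong length p≡) (length-∷ʳ u a))) (≰⇒> long))
  ...   | r , refl , pr = ⊥-elim (extension-not-end r pr ov)

EndRuns : (ℕ → Set) → List BinStr → Set
EndRuns P prev = ∀ d → EndOcc prev (b ∷ a^ d) → P d

endRuns-a^ : ∀ {P prev n} → concat prev ≡ a^ n → EndRuns P prev
endRuns-a^ {n = n} eq d occ = ⊥-elim (b-not-in-a^ n (subst (Factor _) eq (endOcc⇒factor occ)))

endRuns-∷ʳ : ∀ {P prev p} x xs e → EndRuns P prev →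
             concat (prev ++ [ p ]) ≡ blocks (x ∷ xs) (a^ e) → P e → EndRuns P (prev ++ [ p ])
endRuns-∷ʳ {P} {p = p} x xs e runs text≡ Pe d occ with endOcc-∷ʳ⁻ p occ
... | inj₁ occ′ = runs d occ′
... | inj₂ suf  = subst P (sym (last-run-blocks {x = x} {xs} (subst (Suffix _) text≡ suf))) Pe

-- The run aᴺ, N = 2ᵗ⁺¹ − 1, parsed by doubling

runLength : ℕ → ℕ
runLength zero    = 1
runLength (suc t) = suc (runLength t + runLength t)

doubling : ℕ → List BinStr
doubling zero    = [ a^ 1 ]
doubling (suc t) = doubling t ++ [ a^ (suc (runLength t)) ]

concat-doubling : ∀ t → concat (doubling t) ≡ a^ (runLength t)
concat-doubling zero    = refl
concat-doubling (suc t) = begin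
  concat (doubling t ++ [ a^ (suc n) ]) ≡⟨ concat-∷ʳ (doubling t) _ ⟩
  concat (doubling t) ++ a^ (suc n)     ≡⟨ cong (_++ a^ (suc n)) (concat-doubling t) ⟩
  a^ n ++ a^ (suc n)                    ≡⟨ a^-++ n (suc n) ⟩
  a^ (n + suc n)                        ≡⟨ cong a^_ (+-suc n n) ⟩
  a^ (suc (n + n))                      ∎
  where
  open ≡-Reasoning
  n = runLength t

length-doubling : ∀ t → length (doubling t) ≡ suc t
length-doubling zero    = refl
length-doubling (suc t) = trans (length-∷ʳ (doubling t) _) (cong suc (length-doubling t))

phrase77-run : ∀ {prev ps n} → concat prev ≡ a^ n → Phrase77 prev (a^ (suc n)) ps
phrase77-run {prev} {n = n} eq = phrase77-novel {prev} (sym (a^-∷ʳ n)) (suffix⇒factor ([] , sym eq))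
  (λ f → a^-suc-not-in-a^ n (subst (Factor _) eq f))

phraseEnd-run : ∀ {prev ps n} → concat prev ≡ a^ n → PhraseEnd prev (a^ (suc n)) ps
phraseEnd-run {prev} {n = n} eq = phraseEnd-novel {prev} (sym (a^-∷ʳ n)) (endOcc-last ([] , sym eq))
  (λ f → a^-suc-not-in-a^ n (subst (Factor _) eq f))

good77-doubling : ∀ t {rest} → Good77 (doubling t) rest → Good77 [] (doubling t ++ rest)
good77-doubling zero    g = phrase77-run {[]} refl , g
good77-doubling (suc t) {rest} g = subst (Good77 []) (sym (++-assoc (doubling t) _ rest))
  (good77-doubling t (phrase77-run {doubling t} (concat-doubling t) , g))

goodEnd-doubling : ∀ t {rest} → GoodEnd (doubling t) rest → GoodEnd [] (doubling t ++ rest)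
goodEnd-doubling zero    g = phraseEnd-run {[]} refl , g
goodEnd-doubling (suc t) {rest} g = subst (GoodEnd []) (sym (++-assoc (doubling t) _ rest))
  (goodEnd-doubling t (phraseEnd-run {doubling t} (concat-doubling t) , g))

n≤runLength : ∀ t → t ≤ runLength t
n≤runLength zero    = z≤n
n≤runLength (suc t) = s≤s (≤-trans (n≤runLength t) (m≤m+n _ _))

-- The middle of the text

pairs77 : ℕ → ℕ → List BinStr
pairs77 e zero    = []
pairs77 e (suc k) = blocks (e ∷ suc e ∷ []) [] ∷ pairs77 (2 + e) k

midEnd : ℕ → ℕ → List BinStr
midEnd n zero    = [ a ∷ b ∷ [] ]
midEnd n (suc k) = (a ∷ b ∷ a^ (2 + n)) ∷ midEnd (suc n) k

concat-pairs77 : ∀ e k → concat (pairs77 e k) ≡ blocks (upFrom e (k + k)) []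
concat-pairs77 e zero    = refl
concat-pairs77 e (suc k) = begin
  blocks pair [] ++ concat (pairs77 (2 + e) k)      ≡⟨ blocks-++-tail pair [] _ ⟩
  blocks pair (concat (pairs77 (2 + e) k))          ≡⟨ cong (blocks pair) (concat-pairs77 (2 + e) k) ⟩
  blocks (e ∷ suc e ∷ upFrom (2 + e) (k + k)) []    ≡⟨ cong (λ n → blocks (upFrom e (suc n)) []) (+-suc k k) ⟨
  blocks (upFrom e (suc k + suc k)) []              ∎
  where
  open ≡-Reasoning
  pair = e ∷ suc e ∷ []

concat-midEnd : ∀ n k → a^ (suc n) ++ concat (midEnd n k) ≡ blocks (upFrom (2 + n) (suc k)) []
concat-midEnd n zero    = a^-suc (suc n) [ b ]
concat-midEnd n (suc k) =
  trans (a^-suc (suc n) _) (cong (λ s → a^ (2 + n) ++ b ∷ s) (concat-midEnd (suc n) k))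

midEnd-head : ∀ n k → ∃ λ z → concat (midEnd n k) ≡ a ∷ b ∷ z
midEnd-head n zero    = [] , refl
midEnd-head n (suc k) = _ , refl

length-pairs77 : ∀ e k → length (pairs77 e k) ≡ k
length-pairs77 e zero    = refl
length-pairs77 e (suc k) = cong suc (length-pairs77 (2 + e) k)

length-midEnd : ∀ n k → length (midEnd n k) ≡ suc k
length-midEnd n zero    = refl
length-midEnd n (suc k) = cong suc (length-midEnd (suc n) k)

text-∷ʳ : ∀ prev ds s p → concat prev ≡ blocks ds s → concat (prev ++ [ p ]) ≡ blocks ds (s ++ p)
text-∷ʳ prev ds s p eq = trans (concat-∷ʳ prev p) (trans (cong (_++ p) eq) (blocks-++-tail ds s p))

pairs-budget : ∀ e k → e + (suc k + suc k) ≡ 2 + e + (k + k)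
pairs-budget = solve-∀

module Construction (t h : ℕ) (budget : 3 + (h + h) ≤ runLength t) where

  N : ℕ
  N = runLength t

  text : BinStr
  text = blocks (N ∷ suc N ∷ upFrom 2 (suc (h + h))) []

  lz77 : List BinStr
  lz77 = doubling t ++ [ b ] ∷ a^ (suc N) ∷ (b ∷ a^ 2 ++ [ b ]) ∷ pairs77 3 h

  lzEnd : List BinStr
  lzEnd = doubling t ++ [ b ] ∷ a^ (suc N) ∷ (b ∷ a^ 1) ∷ midEnd 0 (h + h)

  1≤N : 1 ≤ N
  1≤N = ≤-trans (s≤s z≤n) budget

  2<N : 2 < N
  2<N = ≤-trans (m≤m+n 3 (h + h)) budget

  -- The last run b aᵈ of a phrase boundary once the middle has reached runs of length lo;
  -- d = N + 1 comes from the boundary after aᴺ⁺¹.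
  LastRun : ℕ → ℕ → Set
  LastRun lo d = d ≤ lo ⊎ d ≡ suc N

  endRuns-suc : ∀ {prev lo} → EndRuns (LastRun lo) prev → EndRuns (LastRun (suc lo)) prev
  endRuns-suc runs d occ = Sum.map₁ m≤n⇒m≤1+n (runs d occ)

  not-end-run : ∀ {prev lo} d → EndRuns (LastRun lo) prev → lo < d → d ≤ N → ¬ EndOcc prev (b ∷ a^ d)
  not-end-run d runs lo<d d≤N occ with runs d occ
  ... | inj₁ d≤lo = <⇒≱ lo<d d≤lo
  ... | inj₂ refl = 1+n≰n d≤N

  good77-pairs : ∀ {prev ms} e k → concat prev ≡ blocks (N ∷ suc N ∷ ms) [] →
                 All (_< e) ms → e + (k + k) ≤ N → Good77 prev (pairs77 e k)
  good77-pairs e zero _ _ _ = tt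
  good77-pairs {prev} {ms} e (suc k) text≡ shorter fits =
      phrase77-novel {prev} (sym (++-assoc (a^ e) (b ∷ a^ (suc e)) [ b ])) occurs novel
    , good77-pairs (2 + e) k text≡′ shorter′ fits′
    where
    fits′ : 2 + e + (k + k) ≤ N
    fits′ = subst (_≤ N) (pairs-budget e k) fits

    e+1<N : suc e < N
    e+1<N = ≤-trans (m≤m+n (2 + e) (k + k)) fits′

    e≤N : e ≤ N
    e≤N = ≤-trans (n≤1+n e) (<⇒≤ e+1<N)

    occurs : Factor (a^ e ++ b ∷ a^ (suc e)) (concat prev)
    occurs = subst (Factor _) (sym text≡) (a^-b-a^-factor _ e≤N (s≤s e≤N))

    novel : ¬ Factor (blocks (e ∷ suc e ∷ []) []) (concat prev)
    novel f = fresh-length e+1<N (All.map m<n⇒m<1+n shorter)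
      (block-factor (N ∷ suc N ∷ ms) 0 (factor-dropˡ (a^ e) (subst (Factor _) text≡ f)))

    text≡′ : concat (prev ++ [ blocks (e ∷ suc e ∷ []) [] ]) ≡ blocks (N ∷ suc N ∷ ms ++ e ∷ suc e ∷ []) []
    text≡′ = trans (text-∷ʳ prev (N ∷ suc N ∷ ms) [] _ text≡) (sym (blocks-++ (N ∷ suc N ∷ ms) (e ∷ suc e ∷ []) []))

    shorter′ : All (_< 2 + e) (ms ++ e ∷ suc e ∷ [])
    shorter′ = ++⁺ (All.map (λ d<e → ≤-trans d<e (m≤n+m e 2)) shorter) (n≤1+n (suc e) ∷ ≤-refl ∷ [])

  goodEnd-mid : ∀ {prev ms} n k → concat prev ≡ blocks (N ∷ suc N ∷ ms) (a^ (suc n)) →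
                All (_< 2 + n) ms → EndRuns (LastRun (suc n)) prev →
                EndOcc prev (a ∷ b ∷ []) → Suffix (a ∷ b ∷ a^ (suc n)) (concat prev) →
                2 + n + k < N → GoodEnd prev (midEnd n k)
  goodEnd-mid n zero _ _ _ ab _ _ = inj₂ (refl , (λ ()) , ab) , tt
  goodEnd-mid {prev} {ms} n (suc k) text≡ shorter runs ab suffix fits =
      phraseEnd-block [ a ] (suc n) (endOcc-last suffix)
        (not-end-run (2 + n) runs ≤-refl (<⇒≤ (<⇒≤ 3+n<N)))
        (not-end-run (3 + n) runs (n≤1+n (2 + n)) (<⇒≤ 3+n<N))
        novel (proj₂ (midEnd-head (suc n) k))
    , goodEnd-mid (suc n) k text≡′ shorter′ (endRuns-∷ʳ N (suc N ∷ ms ++ [ 2 + n ]) (2 + n) (endRuns-suc runs) text≡′ (inj₁ ≤-refl))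
        (endOcc-++ʳ [ p ] ab) (concat prev , sym (concat-∷ʳ prev p)) fits′
    where
    p = a ∷ b ∷ a^ (2 + n)
    D = N ∷ suc N ∷ ms

    fits′ : 3 + n + k < N
    fits′ = subst (_< N) (+-suc (2 + n) k) fits

    3+n<N : 3 + n < N
    3+n<N = ≤-trans (s≤s (m≤m+n (3 + n) k)) fits′

    novel : ¬ Factor (b ∷ a^ (3 + n) ++ [ b ]) (concat prev)
    novel f = fresh-length 3+n<N (All.map m<n⇒m<1+n shorter)
      (block-factor D (suc n) (subst (Factor _) text≡ f))

    text≡′ : concat (prev ++ [ p ]) ≡ blocks (D ++ [ 2 + n ]) (a^ (2 + n))
    text≡′ = begin
      concat (prev ++ [ p ])                 ≡⟨ text-∷ʳ prev D (a^ (suc n)) p text≡ ⟩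
      blocks D (a^ (suc n) ++ p)             ≡⟨ cong (blocks D) (a^-suc (suc n) (b ∷ a^ (2 + n))) ⟩
      blocks D (blocks [ 2 + n ] (a^ (2 + n))) ≡⟨ blocks-++ D [ 2 + n ] _ ⟨
      blocks (D ++ [ 2 + n ]) (a^ (2 + n))   ∎
      where open ≡-Reasoning

    shorter′ : All (_< 3 + n) (ms ++ [ 2 + n ])
    shorter′ = ∷ʳ⁺ (All.map m<n⇒m<1+n shorter) ≤-refl

  P₀ P₁ P₂ : List BinStr
  P₀ = doubling t
  P₁ = P₀ ++ [ [ b ] ]
  P₂ = P₁ ++ [ a^ (suc N) ]

  text₀ : concat P₀ ≡ a^ N
  text₀ = concat-doubling t

  text₁ : concat P₁ ≡ blocks [ N ] (a^ 0)
  text₁ = text-∷ʳ P₀ [] (a^ N) [ b ] text₀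

  text₂ : concat P₂ ≡ blocks [ N ] (a^ (suc N))
  text₂ = text-∷ʳ P₁ [ N ] [] (a^ (suc N)) text₁

  b-novel : ¬ Factor [ b ] (concat P₀)
  b-novel f = b-not-in-a^ N (subst (Factor _) text₀ f)

  a^N+1-novel : ¬ Factor (a^ (suc N)) (concat P₁)
  a^N+1-novel f = a^-suc-not-in-a^-b N (subst (Factor _) text₁ f)

  baab-novel : ¬ Factor (b ∷ a^ 2 ++ [ b ]) (concat P₂)
  baab-novel f with block-factor [ N ] (suc N) (subst (Factor _) text₂ f)
  ... | here 2≡N = <⇒≢ 2<N 2≡N

  good77-lz77 : Good77 [] lz77
  good77-lz77 = good77-doubling t
    ( phrase77-novel {P₀} refl factor-[] b-novel
    , phrase77-novel {P₁} (sym (a^-∷ʳ N)) a^N-occurs a^N+1-novel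
    , phrase77-novel {P₂} refl baa-occurs baab-novel
    , good77-pairs 3 h (text-∷ʳ P₂ [ N ] (a^ (suc N)) (b ∷ a^ 2 ++ [ b ]) text₂) (≤-refl ∷ []) budget )
    where
    a^N-occurs : Factor (a^ N) (concat P₁)
    a^N-occurs = subst (Factor _) (sym text₁) (prefix⇒factor ([ b ] , refl))

    baa-occurs : Factor (b ∷ a^ 2) (concat P₂)
    baa-occurs = subst (Factor _) (sym (trans text₂ (cong (λ s → a^ N ++ b ∷ s) (sym (++-identityʳ _)))))
                   (a^-b-a^-factor {m = N} {n = suc N} [] z≤n (m≤n⇒m≤1+n (<⇒≤ 2<N)))

  goodEnd-lzEnd : GoodEnd [] lzEnd
  goodEnd-lzEnd = goodEnd-doubling t
    ( phraseEnd-novel {P₀} refl endOcc-[] b-novel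
    , phraseEnd-novel {P₁} (sym (a^-∷ʳ N)) a^N-ends a^N+1-novel
    , phraseEnd-block {P₂} [] 0 b-ends (not-end-run 1 runs₂ (s≤s z≤n) 1≤N)
        (not-end-run 2 runs₂ (s≤s z≤n) (<⇒≤ 2<N)) baab-novel (proj₂ (midEnd-head 0 (h + h)))
    , goodEnd-mid 0 (h + h) text₃ [] (endRuns-∷ʳ N [ suc N ] 1 (endRuns-suc runs₂) text₃ (inj₁ ≤-refl))
        ab-ends aba-suffix budget )
    where
    P₃ : List BinStr
    P₃ = P₂ ++ [ b ∷ a^ 1 ]

    text₃ : concat P₃ ≡ blocks (N ∷ suc N ∷ []) (a^ 1)
    text₃ = text-∷ʳ P₂ [ N ] (a^ (suc N)) (b ∷ a^ 1) text₂

    runs₂ : EndRuns (LastRun 0) P₂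
    runs₂ = endRuns-∷ʳ N [] (suc N)
              (endRuns-∷ʳ N [] 0 (endRuns-a^ {prev = P₀} text₀) text₁ (inj₁ z≤n)) text₂ (inj₂ refl)

    a^N-ends : EndOcc P₁ (a^ N)
    a^N-ends = endOcc-++ʳ [ [ b ] ] (endOcc-last {P₀} ([] , sym text₀))

    ab-suffix : Suffix (a ∷ b ∷ []) (concat P₁)
    ab-suffix = subst (Suffix _) (sym text₁) (a^-suffix [ b ] 1≤N)

    b-ends : EndOcc P₂ [ b ]
    b-ends = endOcc-++ʳ [ a^ (suc N) ] (endOcc-last {P₁} (a^ N , sym text₁))

    ab-ends : EndOcc P₃ (a ∷ b ∷ [])
    ab-ends = endOcc-++ʳ [ b ∷ a^ 1 ] (endOcc-++ʳ [ a^ (suc N) ] (endOcc-last {P₁} ab-suffix))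

    aba-suffix : Suffix (a ∷ b ∷ a^ 1) (concat P₃)
    aba-suffix = subst (Suffix _) (sym text₃)
      (suffix-++ˡ (a^ N) (suffix-++ˡ [ b ] (a^-suffix (b ∷ a ∷ []) (s≤s z≤n))))

  concat-lz77 : concat lz77 ≡ text
  concat-lz77 = trans (sym (concat-++ P₀ _))
    (cong₂ _++_ text₀ (cong (λ s → b ∷ a^ (suc N) ++ b ∷ a^ 2 ++ b ∷ s) (concat-pairs77 3 h)))

  concat-lzEnd : concat lzEnd ≡ text
  concat-lzEnd = trans (sym (concat-++ P₀ _))
    (cong₂ _++_ text₀ (cong (λ s → b ∷ a^ (suc N) ++ b ∷ s) (concat-midEnd 0 (h + h))))

  length-lz77 : length lz77 ≡ suc t + (3 + h)
  length-lz77 = trans (length-++ P₀) (cong₂ _+_ (length-doubling t) (cong (3 +_) (length-pairs77 3 h)))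

  length-lzEnd : length lzEnd ≡ suc t + (3 + suc (h + h))
  length-lzEnd = trans (length-++ P₀) (cong₂ _+_ (length-doubling t) (cong (3 +_) (length-midEnd 0 (h + h))))

  t≤length-text : t ≤ length text
  t≤length-text = ≤-trans (n≤runLength t)
    (≤-trans (≤-reflexive (sym (length-replicate N))) (length-++-≤ˡ (a^ N)))

suc-square : ∀ n → suc n * suc n ≡ suc (n * n) + (n + n)
suc-square = solve-∀

n+n≤1+n*n : ∀ n → n + n ≤ suc (n * n)
n+n≤1+n*n zero    = z≤n
n+n≤1+n*n (suc n) = begin
  suc n + suc n               ≡⟨ +-suc (suc n) n ⟩
  suc (suc (n + n))           ≤⟨ s≤s (s≤s (m≤n+m (n + n) (n * n))) ⟩
  suc (suc (n * n + (n + n))) ≡⟨ cong suc (suc-square n) ⟨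
  suc (suc n * suc n)         ∎
  where open ≤-Reasoning

n*n<runLength : ∀ n → n * n < runLength n
n*n<runLength zero    = s≤s z≤n
n*n<runLength (suc n) = s≤s (begin
  suc n * suc n               ≡⟨ suc-square n ⟩
  suc (n * n) + (n + n)       ≤⟨ +-monoʳ-≤ (suc (n * n)) (n+n≤1+n*n n) ⟩
  suc (n * n) + suc (n * n)   ≤⟨ +-mono-≤ (n*n<runLength n) (n*n<runLength n) ⟩
  runLength n + runLength n   ∎)
  where open ≤-Reasoning

square-budget : ∀ k → 3 + (k * k + k * k) ≤ runLength (suc k)
square-budget k = s≤s (subst (_≤ runLength k + runLength k) (cong suc (+-suc (k * k) (k * k)))
  (+-mono-≤ (n*n<runLength k) (n*n<runLength k)))

linear≤square : ∀ {M k} → suc M + 4 ≤ k → (k + 4) * suc M ≤ k * k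
linear≤square {M} {k} M+5≤k = begin
  (k + 4) * suc M        ≡⟨ *-distribʳ-+ (suc M) k 4 ⟩
  k * suc M + 4 * suc M  ≡⟨ cong (k * suc M +_) (*-comm 4 (suc M)) ⟩
  k * suc M + suc M * 4  ≤⟨ +-monoʳ-≤ (k * suc M) (*-monoˡ-≤ 4 (≤-trans (m≤m+n (suc M) 4) M+5≤k)) ⟩
  k * suc M + k * 4      ≡⟨ *-distribˡ-+ k (suc M) 4 ⟨
  k * (suc M + 4)        ≤⟨ *-monoʳ-≤ k M+5≤k ⟩
  k * k                  ∎
  where open ≤-Reasoning

gap⇒ratio→2 : ∀ {zEnd z77 : ℕ → ℕ} → (∀ k → 2 * z77 k ≡ zEnd k + (k + 4)) →
              (∀ k → k * k ≤ z77 k) → RatioTendsTo2 zEnd z77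
gap⇒ratio→2 {zEnd} {z77} gap quadratic M = suc M + 4 , λ k M+5≤k → begin
  ∣ zEnd k - 2 * z77 k ∣ * suc M              ≡⟨ cong (λ x → ∣ zEnd k - x ∣ * suc M) (gap k) ⟩
  ∣ zEnd k - zEnd k + (k + 4) ∣ * suc M       ≡⟨ cong (_* suc M) (∣m-m+n∣≡n (zEnd k) (k + 4)) ⟩
  (k + 4) * suc M                             ≤⟨ linear≤square M+5≤k ⟩
  k * k                                       ≤⟨ quadratic k ⟩
  z77 k                                       ∎
  where open ≤-Reasoning

module Family (k : ℕ) = Construction (suc k) (k * k) (square-budget k)

length-gap : ∀ k → 2 * length (Family.lz77 k) ≡ length (Family.lzEnd k) + (k + 4)
length-gap k = begin
  2 * length (Family.lz77 k)                          ≡⟨ cong (2 *_) (Family.length-lz77 k) ⟩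
  2 * (suc (suc k) + (3 + k * k))                     ≡⟨ counts k ⟩
  suc (suc k) + (3 + suc (k * k + k * k)) + (k + 4)   ≡⟨ cong (_+ (k + 4)) (Family.length-lzEnd k) ⟨
  length (Family.lzEnd k) + (k + 4)                   ∎
  where
  open ≡-Reasoning
  counts : ∀ k → 2 * (suc (suc k) + (3 + k * k)) ≡ suc (suc k) + (3 + suc (k * k + k * k)) + (k + 4)
  counts = solve-∀

square≤length77 : ∀ k → k * k ≤ length (Family.lz77 k)
square≤length77 k = ≤-trans (≤-trans (m≤n+m (k * k) 3) (m≤n+m _ (suc (suc k))))
  (≤-reflexive (sym (Family.length-lz77 k)))

corollary1 : Σ (ℕ → BinStr) λ w →
               (∀ k → k ≤ length (w k))
             × Σ (ℕ → List BinStr) λ f77 →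
                 Σ (ℕ → List BinStr) λ fEnd →
                   (∀ k → IsLZ77 (w k) (f77 k))
                 × (∀ k → IsLZEnd (w k) (fEnd k))
                 × RatioTendsTo2 (λ k → length (fEnd k)) (λ k → length (f77 k))
corollary1 =
    Family.text
  , (λ k → ≤-trans (n≤1+n k) (Family.t≤length-text k))
  , Family.lz77
  , Family.lzEnd
  , (λ k → Family.concat-lz77 k , Family.good77-lz77 k)
  , (λ k → Family.concat-lzEnd k , Family.goodEnd-lzEnd k)
  , gap⇒ratio→2 {λ k → length (Family.lzEnd k)} length-gap square≤length77
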